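{- Let $D$ be a squarefree positive integer, $K=\mathbb{Q}(\sqrt D)$ a real quadratic field with ring of integers $\mathcal{O}_K$, and $\sigma$ the nontrivial automorphism of $K/\mathbb{Q}$ (applied coordinatewise to vectors). Let $Q(\mathbf{x})=x_1^2+x_2^2-x_3^2$ and suppose $\mathbf{v}\in K^3$ satisfies $Q(\mathbf{v})=0$, and that $\mathbf{v}$ and $\mathbf{v}^\sigma$ are linearly independent. If $\mathbf{v}\in(\mathcal{O}_K)^3$, then \[ \mathbf{v}\times_Q\mathbf{v}^\sigma\in\left(\tfrac{\sqrt D}{2}\mathbb{Z}\right)^3, \] i.e.\ each coordinate is of the form $\sqrt{D}\,n/2$ with $n\in\mathbb{Z}$.
   Context: The $Q$-cross product of $(a_1,b_1,c_1)$ and $(a_2,b_2,c_2)$ is $(b_1c_2-b_2c_1,\ a_2c_1-a_1c_2,\ a_2b_1-a_1b_2)$. -}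

module Defs where

open import Data.Nat as ℕ using (ℕ; _≤_; _%_)
open import Data.Nat.Divisibility using (_∣_)
open import Data.Integer as ℤ using (ℤ; +_)
open import Data.Rational as ℚ using (ℚ; _/_; 0ℚ)
open import Data.Product using (_×_; _,_; ∃₂; Σ)
open import Relation.Binary.PropositionalEquality using (_≡_)

SquareFree : ℕ → Set
SquareFree D = ∀ (m : ℕ) → m ℕ.* m ∣ D → m ≡ 1

-- Elements of K = ℚ(√D), written a + b√D with a b ∈ ℚ (basis 1, √D).
record K (D : ℕ) : Set where
  constructor _+_√
  field
    re : ℚ
    im : ℚ
open K public

module _ {D : ℕ} where

  infixl 6 _⊕_ _⊖_
  infixl 7 _⊗_

  ℚD : ℚ
  ℚD = + D / 1

  _⊕_ : K D → K D → K D
  (a + b √) ⊕ (c + d √) = (a ℚ.+ c) + (b ℚ.+ d) √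

  ⊝_ : K D → K D
  ⊝ (a + b √) = (ℚ.- a) + (ℚ.- b) √

  _⊖_ : K D → K D → K D
  x ⊖ y = x ⊕ (⊝ y)

  _⊗_ : K D → K D → K D
  (a + b √) ⊗ (c + d √) = (a ℚ.* c ℚ.+ b ℚ.* d ℚ.* ℚD) + (a ℚ.* d ℚ.+ b ℚ.* c) √

  0K : K D
  0K = 0ℚ + 0ℚ √

  σ : K D → K D
  σ (a + b √) = a + (ℚ.- b) √

-- Ring of integers O_K of ℚ(√D) (D squarefree, D ≠ 1):
--   D ≡ 1 (mod 4):  O_K = ℤ[(1+√D)/2] = { m + n(1+√D)/2 : m n ∈ ℤ }
--   otherwise:      O_K = ℤ[√D]       = { m + n√D     : m n ∈ ℤ }
InOK : (D : ℕ) → K D → Set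
InOK D x with D % 4
... | 1 = ∃₂ λ (m n : ℤ) → x ≡ ((ℤ.+ 2 ℤ.* m ℤ.+ n) / 2) + (n / 2) √
... | _ = ∃₂ λ (m n : ℤ) → x ≡ (m / 1) + (n / 1) √

record K³ (D : ℕ) : Set where
  constructor ⟨_,_,_⟩
  field
    x₁ x₂ x₃ : K D
open K³ public

module _ {D : ℕ} where

  Q : K³ D → K D
  Q ⟨ a , b , c ⟩ = a ⊗ a ⊕ b ⊗ b ⊖ c ⊗ c

  σ³ : K³ D → K³ D
  σ³ ⟨ a , b , c ⟩ = ⟨ σ a , σ b , σ c ⟩

  scale : K D → K³ D → K³ D
  scale k ⟨ a , b , c ⟩ = ⟨ k ⊗ a , k ⊗ b , k ⊗ c ⟩

  add³ : K³ D → K³ D → K³ D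
  add³ ⟨ a , b , c ⟩ ⟨ a' , b' , c' ⟩ = ⟨ a ⊕ a' , b ⊕ b' , c ⊕ c' ⟩

  0³ : K³ D
  0³ = ⟨ 0K , 0K , 0K ⟩

  LinIndep : K³ D → K³ D → Set
  LinIndep u w = ∀ (α β : K D) → add³ (scale α u) (scale β w) ≡ 0³ → (α ≡ 0K) × (β ≡ 0K)

  _×Q_ : K³ D → K³ D → K³ D
  ⟨ a₁ , b₁ , c₁ ⟩ ×Q ⟨ a₂ , b₂ , c₂ ⟩ =
    ⟨ b₁ ⊗ c₂ ⊖ b₂ ⊗ c₁ , a₂ ⊗ c₁ ⊖ a₁ ⊗ c₂ , a₂ ⊗ b₁ ⊖ a₁ ⊗ b₂ ⟩

  InOK³ : K³ D → Set
  InOK³ ⟨ a , b , c ⟩ = InOK D a × InOK D b × InOK D c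

  InHalfSqrtDℤ : K D → Set
  InHalfSqrtDℤ x = Σ ℤ λ n → x ≡ 0ℚ + (n / 2) √

  InHalfSqrtDℤ³ : K³ D → Set
  InHalfSqrtDℤ³ ⟨ a , b , c ⟩ = InHalfSqrtDℤ a × InHalfSqrtDℤ b × InHalfSqrtDℤ c

-- Every integer of ℚ(√D) lies in ½ℤ[√D]; write two coordinates of v as
-- x = (a + b√D)/2 and y = (c + e√D)/2.  Each coordinate of v ×Q σ(v) is
-- ±(x·σ(y) − σ(x)·y), which σ negates: its rational part cancels and its
-- √D-part is 2(bc − ae)/4 = (bc − ae)/2.
module Submission where

open import Defs
open import Data.Nat using (ℕ; _≤_; suc)
import Data.Nat as ℕ
open import Data.Integer as ℤ using (ℤ; +_)
import Data.Integer.Properties as ℤP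
open import Data.Integer.Tactic.RingSolver using (solve-∀)
open import Data.Rational as ℚ using (ℚ; _/_; 0ℚ; fromℚᵘ)
import Data.Rational.Properties as ℚP
open import Data.Rational.Solver using (module +-*-Solver)
open import Data.Rational.Unnormalised as ℚᵘ using (ℚᵘ; mkℚᵘ; *≡*)
import Data.Rational.Unnormalised.Properties as ℚᵘP
open import Data.Product using (_,_; ∃₂)
open import Relation.Binary.PropositionalEquality
  using (_≡_; refl; sym; trans; cong; cong₂; subst; module ≡-Reasoning)

fromℚᵘ-homo-+ : ∀ p q → fromℚᵘ (p ℚᵘ.+ q) ≡ fromℚᵘ p ℚ.+ fromℚᵘ q
fromℚᵘ-homo-+ p q = ℚP.toℚᵘ-injective (ℚᵘP.≃-trans (ℚP.toℚᵘ-fromℚᵘ (p ℚᵘ.+ q))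
  (ℚᵘP.≃-sym (ℚᵘP.≃-trans (ℚP.toℚᵘ-homo-+ (fromℚᵘ p) (fromℚᵘ q))
    (ℚᵘP.+-cong (ℚP.toℚᵘ-fromℚᵘ p) (ℚP.toℚᵘ-fromℚᵘ q)))))

fromℚᵘ-homo-* : ∀ p q → fromℚᵘ (p ℚᵘ.* q) ≡ fromℚᵘ p ℚ.* fromℚᵘ q
fromℚᵘ-homo-* p q = ℚP.toℚᵘ-injective (ℚᵘP.≃-trans (ℚP.toℚᵘ-fromℚᵘ (p ℚᵘ.* q))
  (ℚᵘP.≃-sym (ℚᵘP.≃-trans (ℚP.toℚᵘ-homo-* (fromℚᵘ p) (fromℚᵘ q))
    (ℚᵘP.*-cong (ℚP.toℚᵘ-fromℚᵘ p) (ℚP.toℚᵘ-fromℚᵘ q)))))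

fromℚᵘ-homo‿- : ∀ p → fromℚᵘ (ℚᵘ.- p) ≡ ℚ.- fromℚᵘ p
fromℚᵘ-homo‿- p = ℚP.toℚᵘ-injective (ℚᵘP.≃-trans (ℚP.toℚᵘ-fromℚᵘ (ℚᵘ.- p))
  (ℚᵘP.≃-sym (ℚᵘP.≃-trans (ℚP.toℚᵘ-homo‿- (fromℚᵘ p))
    (ℚᵘP.-‿cong (ℚP.toℚᵘ-fromℚᵘ p)))))

fromℚᵘ-homo-- : ∀ p q → fromℚᵘ (p ℚᵘ.- q) ≡ fromℚᵘ p ℚ.- fromℚᵘ q
fromℚᵘ-homo-- p q = trans (fromℚᵘ-homo-+ p (ℚᵘ.- q)) (cong (fromℚᵘ p ℚ.+_) (fromℚᵘ-homo‿- q))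

i/1≡[i*2]/2 : ∀ i → i / 1 ≡ (i ℤ.* + 2) / 2
i/1≡[i*2]/2 i =
  ℚP.fromℚᵘ-cong {mkℚᵘ i 0} {mkℚᵘ (i ℤ.* + 2) 1} (*≡* (sym (ℤP.*-identityʳ (i ℤ.* + 2))))

double-cross-of-halves : ∀ a b c e →
  let d = (b / 2) ℚ.* (c / 2) ℚ.- (a / 2) ℚ.* (e / 2) in
  d ℚ.+ d ≡ (b ℤ.* c ℤ.- a ℤ.* e) / 2
double-cross-of-halves a b c e = begin
  d ℚ.+ d                     ≡⟨ cong₂ ℚ._+_ fromℚᵘ-t≡d fromℚᵘ-t≡d ⟨
  fromℚᵘ t ℚ.+ fromℚᵘ t       ≡⟨ fromℚᵘ-homo-+ t t ⟨
  fromℚᵘ (t ℚᵘ.+ t)           ≡⟨ ℚP.fromℚᵘ-cong {t ℚᵘ.+ t} {mkℚᵘ (b ℤ.* c ℤ.- a ℤ.* e) 1}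
                                                  (*≡* (cross-multiplied a b c e)) ⟩
  (b ℤ.* c ℤ.- a ℤ.* e) / 2   ∎
  where
  open ≡-Reasoning
  -- mkℚᵘ n 1 has denominator 2, so fromℚᵘ (mkℚᵘ n 1) is n / 2 by definition
  a′ b′ c′ e′ : ℚᵘ
  a′ = mkℚᵘ a 1; b′ = mkℚᵘ b 1; c′ = mkℚᵘ c 1; e′ = mkℚᵘ e 1
  t : ℚᵘ
  t = b′ ℚᵘ.* c′ ℚᵘ.- a′ ℚᵘ.* e′
  d : ℚ
  d = (b / 2) ℚ.* (c / 2) ℚ.- (a / 2) ℚ.* (e / 2)
  fromℚᵘ-t≡d : fromℚᵘ t ≡ d
  fromℚᵘ-t≡d = begin
    fromℚᵘ t                                    ≡⟨ fromℚᵘ-homo-- (b′ ℚᵘ.* c′) (a′ ℚᵘ.* e′) ⟩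
    fromℚᵘ (b′ ℚᵘ.* c′) ℚ.- fromℚᵘ (a′ ℚᵘ.* e′) ≡⟨ cong₂ ℚ._-_ (fromℚᵘ-homo-* b′ c′)
                                                               (fromℚᵘ-homo-* a′ e′) ⟩
    d                                           ∎
  -- t + t ≃ (bc − ae)/2 with numerators and denominators as ℚᵘ computes them
  cross-multiplied : ∀ a b c e →
    let n = b ℤ.* c ℤ.* + 4 ℤ.+ ℤ.- (a ℤ.* e) ℤ.* + 4 in
    (n ℤ.* + 16 ℤ.+ n ℤ.* + 16) ℤ.* + 2
      ≡ (b ℤ.* c ℤ.- a ℤ.* e) ℤ.* + 256
  cross-multiplied = solve-∀

module _ {D : ℕ} where

  HalfIntegral : K D → Set
  HalfIntegral x = ∃₂ λ a b → x ≡ (a / 2) + (b / 2) √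

  integral⇒halfIntegral : ∀ {x} → ∃₂ (λ m n → x ≡ (m / 1) + (n / 1) √) → HalfIntegral x
  integral⇒halfIntegral (m , n , refl) =
    m ℤ.* + 2 , n ℤ.* + 2 , cong₂ _+_√ (i/1≡[i*2]/2 m) (i/1≡[i*2]/2 n)

  InOK⇒halfIntegral : ∀ {x} → InOK D x → HalfIntegral x
  InOK⇒halfIntegral x∈O with D ℕ.% 4
  ... | 0           = integral⇒halfIntegral x∈O
  ... | 1           = let m , n , x≡ = x∈O in + 2 ℤ.* m ℤ.+ n , n , x≡
  ... | suc (suc _) = integral⇒halfIntegral x∈O

  ⊗-comm : ∀ (x y : K D) → x ⊗ y ≡ y ⊗ x
  ⊗-comm (p + q √) (r + s √) = cong₂ _+_√
    (solve 5 (λ p q r s d → p :* r :+ q :* s :* d := r :* p :+ s :* q :* d) refl p q r s (ℚD {D}))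
    (solve 4 (λ p q r s → p :* s :+ q :* r := r :* q :+ s :* p) refl p q r s)
    where open +-*-Solver

  ⊗σ-⊖-σ⊗ : ∀ (x y : K D) → let d = im x ℚ.* re y ℚ.- re x ℚ.* im y in
    x ⊗ σ y ⊖ σ x ⊗ y ≡ 0ℚ + (d ℚ.+ d) √
  ⊗σ-⊖-σ⊗ (p + q √) (r + s √) = cong₂ _+_√
    (solve 5 (λ p q r s d → (p :* r :+ q :* (:- s) :* d) :+ :- (p :* r :+ (:- q) :* s :* d)
                           := con 0ℚ)
      refl p q r s (ℚD {D}))
    (solve 4 (λ p q r s → (p :* (:- s) :+ q :* r) :+ :- (p :* s :+ (:- q) :* r)
                         := (q :* r :+ :- (p :* s)) :+ (q :* r :+ :- (p :* s)))
      refl p q r s)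
    where open +-*-Solver

  halfIntegral-⊗σ-⊖-σ⊗ : ∀ {x y} → HalfIntegral x → HalfIntegral y →
                         InHalfSqrtDℤ (x ⊗ σ y ⊖ σ x ⊗ y)
  halfIntegral-⊗σ-⊖-σ⊗ (a , b , refl) (c , e , refl) =
    b ℤ.* c ℤ.- a ℤ.* e ,
    trans (⊗σ-⊖-σ⊗ ((a / 2) + (b / 2) √) ((c / 2) + (e / 2) √))
          (cong (λ z → 0ℚ + z √) (double-cross-of-halves a b c e))

  halfIntegral-σ⊗-⊖-⊗σ : ∀ {x y} → HalfIntegral x → HalfIntegral y →
                         InHalfSqrtDℤ (σ x ⊗ y ⊖ x ⊗ σ y)
  halfIntegral-σ⊗-⊖-⊗σ {x} {y} x½ y½ =
    subst InHalfSqrtDℤ (cong₂ _⊖_ (⊗-comm y (σ x)) (⊗-comm (σ y) x)) (halfIntegral-⊗σ-⊖-σ⊗ y½ x½)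

proposition3p5 : (D : ℕ) → 2 ≤ D → SquareFree D → (v : K³ D) →
    Q v ≡ 0K → LinIndep v (σ³ v) → InOK³ v →
    InHalfSqrtDℤ³ (v ×Q σ³ v)
proposition3p5 D _ _ ⟨ a , b , c ⟩ _ _ (a∈O , b∈O , c∈O) =
  halfIntegral-⊗σ-⊖-σ⊗ b½ c½ , halfIntegral-σ⊗-⊖-⊗σ a½ c½ , halfIntegral-σ⊗-⊖-⊗σ a½ b½
  where
  a½ : HalfIntegral a
  a½ = InOK⇒halfIntegral a∈O
  b½ : HalfIntegral b
  b½ = InOK⇒halfIntegral b∈O
  c½ : HalfIntegral c
  c½ = InOK⇒halfIntegral c∈O
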